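{- Let $k\ge 1$ and let $G$ be a graph with minimum degree at least $k$. Let $a$ be a number with $\delta(G)\ge a+k$. If $\gamma_{\times k,t}(G)\le a$, then $\gamma_{\times k,t}^{r}(G)\le a$.
   Context: All graphs are finite and simple; $N(x)$ denotes the open neighborhood of $x$ and $\delta(G)$ the minimum degree. For an integer $k\ge 1$, a set $S\subseteq V(G)$ is a $k$-tuple total dominating set (kTDS) of $G$ if $|N(x)\cap S|\ge k$ for every $x\in V(G)$; $\gamma_{\times k,t}(G)$ is the minimum cardinality of a kTDS. A kTDS $S$ is a $k$-tuple total restrained dominating set (kTRDS) if moreover every vertex $x\in V(G)\setminus S$ is adjacent to at least $k$ vertices of $V(G)\setminus S$; $\gamma_{\times k,t}^{r}(G)$ is the minimum cardinality of a kTRDS. -}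

module Defs where

open import Data.Nat using (ℕ; _≤_; _+_)
open import Data.Bool using (Bool; true; false; _∧_; not)
open import Data.Fin using (Fin)
open import Data.Fin.Subset using (Subset; _∈_; _∉_; ∣_∣; ⁅_⁆)
open import Data.Vec using (Vec; lookup; count; tabulate; allFin)
open import Data.Vec.Functional using () 
open import Data.Product using (Σ; _×_; ∃)
open import Relation.Binary.PropositionalEquality using (_≡_)
open import Relation.Nullary using (¬_)

record Graph (n : ℕ) : Set where
  field
    adj   : Fin n → Fin n → Bool
    sym   : ∀ x y → adj x y ≡ adj y x
    irrefl : ∀ x → adj x x ≡ false
open Graph public

nbrsIn : ∀ {n} → Graph n → Subset n → Fin n → ℕ
nbrsIn G S x = count (λ b → b Data.Bool.≟ true)
                 (tabulate (λ y → adj G x y ∧ lookup S y))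

compl : ∀ {n} → Subset n → Subset n
compl S = Data.Vec.map not S

degree : ∀ {n} → Graph n → Fin n → ℕ
degree {n} G x = nbrsIn G (tabulate (λ _ → true)) x

minDegree≥ : ∀ {n} → Graph n → ℕ → Set
minDegree≥ G m = ∀ x → m ≤ degree G x

IsKTDS : ∀ {n} → ℕ → Graph n → Subset n → Set
IsKTDS k G S = ∀ x → k ≤ nbrsIn G S x

IsKTRDS : ∀ {n} → ℕ → Graph n → Subset n → Set
IsKTRDS k G S = IsKTDS k G S × (∀ x → x ∉ S → k ≤ nbrsIn G (compl S) x)

γkt≤ : ∀ {n} → ℕ → Graph n → ℕ → Set
γkt≤ k G a = Σ (Subset _) λ S → IsKTDS k G S × ∣ S ∣ ≤ a

γrkt≤ : ∀ {n} → ℕ → Graph n → ℕ → Set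
γrkt≤ k G a = Σ (Subset _) λ S → IsKTRDS k G S × ∣ S ∣ ≤ a

module Submission where

-- The given kTDS S is itself restrained: a vertex x has at most |S| ≤ a
-- neighbours in S, so at least deg x − a ≥ k neighbours outside S.

open import Defs
open import Data.Nat as ℕ using (ℕ; _≤_; _+_; z≤n; s≤s)
open import Data.Nat.Properties using (+-suc; m≤n⇒m≤1+n; ≤-trans; +-monoˡ-≤; +-cancelˡ-≤; module ≤-Reasoning)
open import Data.Bool using (Bool; true; false; _∧_; not)
open import Data.Fin using (Fin; zero; suc)
open import Data.Fin.Subset using (Subset; ∣_∣)
open import Data.Vec using ([]; _∷_; lookup; tabulate; count; map)
open import Data.Product using (_,_)
open import Function using (_∘_)
open import Relation.Binary.PropositionalEquality using (_≡_; refl; cong; trans)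

countWithin : ∀ {m} → (Fin m → Bool) → Subset m → ℕ
countWithin f S = count (Data.Bool._≟ true) (tabulate (λ y → f y ∧ lookup S y))

countWithin-+-compl : ∀ {m} (f : Fin m → Bool) (S : Subset m) →
  countWithin f S + countWithin f (map not S) ≡ countWithin f (tabulate (λ _ → true))
countWithin-+-compl f [] = refl
countWithin-+-compl f (true ∷ S) with f zero | countWithin-+-compl (f ∘ suc) S
... | true  | ih = cong ℕ.suc ih
... | false | ih = ih
countWithin-+-compl f (false ∷ S) with f zero | countWithin-+-compl (f ∘ suc) S
... | true  | ih = trans (+-suc _ _) (cong ℕ.suc ih)
... | false | ih = ih

countWithin≤∣S∣ : ∀ {m} (f : Fin m → Bool) (S : Subset m) → countWithin f S ≤ ∣ S ∣
countWithin≤∣S∣ f [] = z≤n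
countWithin≤∣S∣ f (true ∷ S) with f zero | countWithin≤∣S∣ (f ∘ suc) S
... | true  | ih = s≤s ih
... | false | ih = m≤n⇒m≤1+n ih
countWithin≤∣S∣ f (false ∷ S) with f zero | countWithin≤∣S∣ (f ∘ suc) S
... | true  | ih = ih
... | false | ih = ih

nbrsIn-+-compl : ∀ {n} (G : Graph n) (S : Subset n) x →
  nbrsIn G S x + nbrsIn G (compl S) x ≡ degree G x
nbrsIn-+-compl G S x = countWithin-+-compl (adj G x) S

nbrsIn≤∣S∣ : ∀ {n} (G : Graph n) (S : Subset n) x → nbrsIn G S x ≤ ∣ S ∣
nbrsIn≤∣S∣ G S x = countWithin≤∣S∣ (adj G x) S

nbrsIn-compl-≥ : ∀ {n} (G : Graph n) (S : Subset n) {a k} x →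
  ∣ S ∣ ≤ a → a + k ≤ degree G x → k ≤ nbrsIn G (compl S) x
nbrsIn-compl-≥ G S {a} {k} x ∣S∣≤a a+k≤deg = +-cancelˡ-≤ a k _ (begin
  a + k                                    ≤⟨ a+k≤deg ⟩
  degree G x                               ≡⟨ nbrsIn-+-compl G S x ⟨
  nbrsIn G S x + nbrsIn G (compl S) x      ≤⟨ +-monoˡ-≤ _ (≤-trans (nbrsIn≤∣S∣ G S x) ∣S∣≤a) ⟩
  a + nbrsIn G (compl S) x                 ∎)
  where open ≤-Reasoning

theorem3p5 : (k a n : ℕ) → 1 ≤ k → (G : Graph n) → minDegree≥ G k → minDegree≥ G (a + k) → γkt≤ k G a → γrkt≤ k G a
theorem3p5 k a n _ G _ δ≥a+k (S , isKTDS , ∣S∣≤a) =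
  S , (isKTDS , λ x _ → nbrsIn-compl-≥ G S x ∣S∣≤a (δ≥a+k x)) , ∣S∣≤a
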